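{- Let $G$ be a connected graph with at least $3$ vertices and at most two blocks. If $G$ has diameter $2$ and contains no induced cycle of length $5$, then $G$ is $2$-bootstrap good, i.e., there exist two vertices $a,b\in V(G)$ such that $\{a,b\}$ percolates in $G$ with threshold $r=2$.
   Context: Bootstrap percolation with threshold $r$ on a finite simple graph $G$: starting from an initially infected set $A_0\subseteq V(G)$, define $A_t=A_{t-1}\cup\{v\in V(G): |N(v)\cap A_{t-1}|\ge r\}$ for $t\ge 1$. Infected vertices stay infected. The closure $\langle A_0\rangle$ is the final infected set; $A_0$ percolates if $\langle A_0\rangle=V(G)$. A graph is $2$-bootstrap good ($2$-BG) if it contains a set of two vertices that percolates with threshold $2$. A block of $G$ is a maximal connected subgraph of $G$ with no cut vertex. -}

module Defs where

open import Data.Nat using (ℕ; zero; suc; _≤_; _+_)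
open import Data.Bool using (Bool; true; false; _∧_)
open import Data.Fin using (Fin; zero; suc)
open import Data.Fin.Subset using (Subset; _∈_; _∉_; _∩_; _∪_; ⁅_⁆; ⊤; ∣_∣; _⊆_)
open import Data.Vec using (tabulate)
open import Data.Product using (Σ; ∃; ∃-syntax; _×_; _,_)
open import Data.Sum using (_⊎_)
open import Relation.Nullary using (¬_)
open import Relation.Binary.PropositionalEquality using (_≡_; _≢_)
open import Function.Definitions using (Injective)

record Graph (n : ℕ) : Set where
  field
    adj    : Fin n → Fin n → Bool
    sym    : ∀ u v → adj u v ≡ adj v u
    irrefl : ∀ v → adj v v ≡ false
open Graph public

Adj : ∀ {n} → Graph n → Fin n → Fin n → Set
Adj G u v = adj G u v ≡ true

data WalkIn {n} (G : Graph n) (S : Subset n) : Fin n → Fin n → Set where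
  here : ∀ {u} → u ∈ S → WalkIn G S u u
  step : ∀ {u w v} → u ∈ S → Adj G u w → WalkIn G S w v → WalkIn G S u v

ConnectedIn : ∀ {n} → Graph n → Subset n → Set
ConnectedIn G S = ∀ u v → u ∈ S → v ∈ S → WalkIn G S u v

Connected : ∀ {n} → Graph n → Set
Connected G = ConnectedIn G ⊤

_─_ : ∀ {n} → Subset n → Fin n → Subset n
_─_ {n} S v = tabulate (λ w → rm w)
  where
  open import Data.Fin using (_≟_)
  open import Relation.Nullary using (yes; no)
  open import Data.Vec using (lookup)
  rm : Fin n → Bool
  rm w with w ≟ v
  ... | yes _ = false
  ... | no _  = lookup S w

CutVertexIn : ∀ {n} → Graph n → Subset n → Fin n → Set
CutVertexIn G S v =
  v ∈ S × ∃[ x ] ∃[ y ] (x ∈ (S ─ v) × y ∈ (S ─ v) × ¬ WalkIn G (S ─ v) x y)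

Biconn : ∀ {n} → Graph n → Subset n → Set
Biconn G S = ConnectedIn G S × (∀ v → ¬ CutVertexIn G S v)

-- A block: (the vertex set of) a maximal connected subgraph with no cut vertex.
-- (A maximal such subgraph is induced, so it is determined by its vertex set.)
IsBlock : ∀ {n} → Graph n → Subset n → Set
IsBlock G S = Biconn G S × (∀ T → S ⊆ T → Biconn G T → T ≡ S)

AtMostTwoBlocks : ∀ {n} → Graph n → Set
AtMostTwoBlocks G = ∀ B₁ B₂ B₃ → IsBlock G B₁ → IsBlock G B₂ → IsBlock G B₃ →
  (B₁ ≡ B₂) ⊎ (B₁ ≡ B₃) ⊎ (B₂ ≡ B₃)

DistLe2 : ∀ {n} → Graph n → Fin n → Fin n → Set
DistLe2 G u v = u ≡ v ⊎ Adj G u v ⊎ ∃[ w ] (Adj G u w × Adj G w v)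

Diameter2 : ∀ {n} → Graph n → Set
Diameter2 G = Connected G × (∀ u v → DistLe2 G u v)
  × ∃[ u ] ∃[ v ] (¬ (u ≡ v ⊎ Adj G u v))

next5 : Fin 5 → Fin 5
next5 zero = suc zero
next5 (suc zero) = suc (suc zero)
next5 (suc (suc zero)) = suc (suc (suc zero))
next5 (suc (suc (suc zero))) = suc (suc (suc (suc zero)))
next5 (suc (suc (suc (suc zero)))) = zero

HasInducedC5 : ∀ {n} → Graph n → Set
HasInducedC5 {n} G = Σ (Fin 5 → Fin n) λ f → Injective _≡_ _≡_ f ×
  (∀ i j → Adj G (f i) (f j) → (j ≡ next5 i ⊎ i ≡ next5 j)) ×
  (∀ i → Adj G (f i) (f (next5 i)))

neighbours : ∀ {n} → Graph n → Fin n → Subset n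
neighbours G v = tabulate (adj G v)

bootStep : ∀ {n} → ℕ → Graph n → Subset n → Subset n
bootStep {n} r G A = tabulate f
  where
  open import Data.Vec using (lookup)
  open import Data.Nat using (_≤ᵇ_)
  open import Data.Bool using (_∨_)
  f : Fin n → Bool
  f v = lookup A v ∨ (r ≤ᵇ ∣ neighbours G v ∩ A ∣)

bootIter : ∀ {n} → ℕ → Graph n → Subset n → ℕ → Subset n
bootIter r G A zero = A
bootIter r G A (suc t) = bootStep r G (bootIter r G A t)

-- A₀ percolates: the closure ⟨A₀⟩ = ⋃ₜ Aₜ is all of V(G) (for finite G, iff some Aₜ = V).
Percolates : ∀ {n} → ℕ → Graph n → Subset n → Set
Percolates r G A = ∃[ t ] (bootIter r G A t ≡ ⊤)

TwoBG : ∀ {n} → Graph n → Set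
TwoBG G = ∃[ a ] ∃[ b ] (a ≢ b × Percolates 2 G (⁅ a ⁆ ∪ ⁅ b ⁆))

module Submission where

-- Write ⟪ a , b ⟫ for the threshold-2 closure of {a, b}: the least vertex set containing a and b
-- that contains every vertex with two neighbours in it. In a C5-free graph in which all distances
-- are at most 2, a vertex x of a closed set S with a neighbour y outside S is adjacent to every
-- other vertex c of S: otherwise paths y - w - c and x - u - c close up an induced pentagon
-- y x u c w. Now take a pair a, b whose closure S is not everything, and an edge xy leaving S.
-- If another vertex x′ of S has a neighbour outside S, then ⟪ y , x′ ⟫ contains x, hence all of
-- S, and y. Otherwise x is adjacent to every vertex of G; then each ⟪ x , w ⟫ is a block, and
-- for s ∈ S with s ≠ x either ⟪ s , y ⟫ is everything or a vertex v outside it yields three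
-- distinct blocks ⟪ x , s ⟫, ⟪ x , y ⟫, ⟪ x , v ⟫. Closures cannot grow forever, so some pair
-- percolates.

open import Defs hiding (sym)
open import Data.Nat using (ℕ; zero; suc; _+_; _≤_; _<_; z≤n; s≤s)
open import Data.Nat.Properties
  using (≤ᵇ⇒≤; ≤⇒≤ᵇ; ≤-trans; ≤-<-trans; <-≤-trans; ≤-antisym; n≮n; +-suc; +-monoʳ-≤; m≤m+n; module ≤-Reasoning)
open import Data.Bool using (Bool; true)
open import Data.Bool.Properties using (T-≡; T-∨) renaming (_≟_ to _≟ᵇ_)
open import Function.Bundles using (Equivalence)
open Equivalence using (to; from)
open import Data.Fin using (Fin; zero; suc; _≟_)
open import Data.Fin.Subset using (Subset; _∈_; _∉_; _∩_; _∪_; ⁅_⁆; ⊤; ∣_∣; _⊆_; _⊂_)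
open import Data.Fin.Subset.Properties
  using (_∈?_; _⊂?_; ∈⊤; ⊆⊤; ⊆-antisym; x∈⁅x⁆; x∈⁅y⁆⇒x≡y; x∈p∪q⁺; x∈p∪q⁻; p∩q⊆p; p∩q⊆q; x∈p∩q⁺; x∈p∩q⁻
        ; ∣⁅x⁆∣≡1; ∣p∣≤n; ∣p∣≡n⇒p≡⊤; p⊆q⇒∣p∣≤∣q∣; p⊂q⇒∣p∣<∣q∣)
open import Data.Fin.Properties using (any?; all?)
open import Data.Vec using (lookup; tabulate; []; _∷_)
open import Data.Vec.Properties using ([]=⇒lookup; lookup⇒[]=; lookup∘tabulate)
open import Data.Product using (∃-syntax; _×_; _,_; proj₁; proj₂)
open import Data.Sum using (_⊎_; inj₁; inj₂; [_,_]′)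
open import Data.Empty using (⊥; ⊥-elim)
open import Relation.Nullary using (Dec; ¬_; yes; no; contradiction)
open import Relation.Nullary.Decidable using (decidable-stable; _×-dec_; _⊎-dec_; ¬?; from-yes)
open import Function using (_∋_; _∘_)
open import Function.Definitions using (Injective)
open import Relation.Binary.PropositionalEquality using (_≡_; _≢_; refl; sym; trans; subst)

module _ {n} {x : Fin n} where

  ∈-tabulate⁻ : ∀ (f : Fin n → Bool) → x ∈ tabulate f → f x ≡ true
  ∈-tabulate⁻ f x∈ = trans (sym (lookup∘tabulate f x)) ([]=⇒lookup x∈)

  ∈-tabulate⁺ : ∀ (f : Fin n → Bool) → f x ≡ true → x ∈ tabulate f
  ∈-tabulate⁺ f fx = lookup⇒[]= x (tabulate f) (trans (lookup∘tabulate f x) fx)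

  ∈-─⁻ : ∀ {S v} → x ∈ S ─ v → x ∈ S × x ≢ v
  ∈-─⁻ {S} {v} x∈ with ∈-tabulate⁻ _ x∈
  ... | rm≡true with x ≟ v
  ...   | no x≢v = lookup⇒[]= x S rm≡true , x≢v

  ∈-─⁺ : ∀ {S v} → x ∈ S → x ≢ v → x ∈ S ─ v
  ∈-─⁺ {S} {v} x∈S x≢v with (lookup (S ─ v) x ≡ _) ∋ lookup∘tabulate _ x
  ... | lookup≡rm with x ≟ v
  ...   | yes x≡v = contradiction x≡v x≢v
  ...   | no _    = lookup⇒[]= x (S ─ v) (trans lookup≡rm ([]=⇒lookup x∈S))

module _ {n} {p : Subset n} where

  2≤∣p∣⇒∃≢ : 2 ≤ ∣ p ∣ → ∀ x → ∃[ w ] (w ∈ p × w ≢ x)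
  2≤∣p∣⇒∃≢ 2≤∣p∣ x with any? (λ w → w ∈? p ×-dec ¬? (w ≟ x))
  ... | yes found = found
  ... | no none   = contradiction (≤-trans 2≤∣p∣ ∣p∣≤1) (n≮n 1)
    where
    p⊆⁅x⁆ : p ⊆ ⁅ x ⁆
    p⊆⁅x⁆ {w} w∈p with w ≟ x
    ... | yes refl = x∈⁅x⁆ x
    ... | no w≢x   = contradiction (w , w∈p , w≢x) none
    ∣p∣≤1 : ∣ p ∣ ≤ 1
    ∣p∣≤1 = subst (∣ p ∣ ≤_) (∣⁅x⁆∣≡1 x) (p⊆q⇒∣p∣≤∣q∣ p⊆⁅x⁆)

  ≢-members⇒2≤∣p∣ : ∀ {u w} → u ≢ w → u ∈ p → w ∈ p → 2 ≤ ∣ p ∣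
  ≢-members⇒2≤∣p∣ {u} {w} u≢w u∈p w∈p =
    subst (λ k → suc k ≤ ∣ p ∣) (∣⁅x⁆∣≡1 w) (p⊂q⇒∣p∣<∣q∣ ⁅w⁆⊂p)
    where
    ⁅w⁆⊂p : ⁅ w ⁆ ⊂ p
    ⁅w⁆⊂p = (λ v∈⁅w⁆ → subst (_∈ p) (sym (x∈⁅y⁆⇒x≡y w v∈⁅w⁆)) w∈p)
          , u , u∈p , λ u∈⁅w⁆ → u≢w (x∈⁅y⁆⇒x≡y w u∈⁅w⁆)

module _ {n} (G : Graph n) where

  Adj? : ∀ u v → Dec (Adj G u v)
  Adj? u v = adj G u v ≟ᵇ true

  Adj-sym : ∀ {u v} → Adj G u v → Adj G v u
  Adj-sym {u} {v} u~v = trans (Graph.sym G v u) u~v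

  Adj⇒≢ : ∀ {u v} → Adj G u v → u ≢ v
  Adj⇒≢ {u} u~u refl with trans (sym u~u) (irrefl G u)
  ... | ()

  ∈-neighbours⁻ : ∀ {v u} → u ∈ neighbours G v → Adj G v u
  ∈-neighbours⁻ {v} = ∈-tabulate⁻ (adj G v)

  ∈-neighbours⁺ : ∀ {v u} → Adj G v u → u ∈ neighbours G v
  ∈-neighbours⁺ {v} = ∈-tabulate⁺ (adj G v)

module _ {n} (r : ℕ) (G : Graph n) where

  ∈-bootStep⁻ : ∀ {A v} → v ∈ bootStep r G A → v ∈ A ⊎ r ≤ ∣ neighbours G v ∩ A ∣
  ∈-bootStep⁻ {A} {v} v∈ with T-∨ .to (T-≡ .from (∈-tabulate⁻ _ v∈))
  ... | inj₁ seed      = inj₁ (lookup⇒[]= v A (T-≡ .to seed))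
  ... | inj₂ threshold = inj₂ (≤ᵇ⇒≤ r _ threshold)

  A⊆bootStep : ∀ {A} → A ⊆ bootStep r G A
  A⊆bootStep {A} {v} v∈A = ∈-tabulate⁺ _ (T-≡ .to (T-∨ .from (inj₁ (T-≡ .from ([]=⇒lookup v∈A)))))

  ∈-bootStep⁺ : ∀ {A v} → r ≤ ∣ neighbours G v ∩ A ∣ → v ∈ bootStep r G A
  ∈-bootStep⁺ r≤ = ∈-tabulate⁺ _ (T-≡ .to (T-∨ .from (inj₂ (≤⇒≤ᵇ r≤))))

  bootStep-mono : ∀ {A B} → A ⊆ B → bootStep r G A ⊆ bootStep r G B
  bootStep-mono {A} {B} A⊆B {v} v∈ with ∈-bootStep⁻ v∈
  ... | inj₁ v∈A = A⊆bootStep (A⊆B v∈A)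
  ... | inj₂ r≤  = ∈-bootStep⁺ (≤-trans r≤ (p⊆q⇒∣p∣≤∣q∣ N∩A⊆N∩B))
    where
    N∩A⊆N∩B : neighbours G v ∩ A ⊆ neighbours G v ∩ B
    N∩A⊆N∩B u∈ = x∈p∩q⁺ (p∩q⊆p _ _ u∈ , A⊆B (p∩q⊆q _ _ u∈))

  A⊆bootIter : ∀ {A} t → A ⊆ bootIter r G A t
  A⊆bootIter zero    v∈A = v∈A
  A⊆bootIter (suc t) v∈A = A⊆bootStep (A⊆bootIter t v∈A)

  private
    grows-or-settles : ∀ A → ∣ A ∣ < ∣ bootStep r G A ∣ ⊎ bootStep r G A ⊆ A
    grows-or-settles A with A ⊂? bootStep r G A
    ... | yes A⊂ = inj₁ (p⊂q⇒∣p∣<∣q∣ A⊂)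
    ... | no A⊄  = inj₂ settled
      where
      settled : bootStep r G A ⊆ A
      settled {v} v∈ with v ∈? A
      ... | yes v∈A = v∈A
      ... | no v∉A  = contradiction ((λ {u} → A⊆bootStep) , v , v∈ , v∉A) A⊄

    large-or-settled : ∀ A t → t < ∣ bootIter r G A (suc t) ∣ ⊎ bootIter r G A (suc t) ⊆ bootIter r G A t
    large-or-settled A zero with grows-or-settles A
    ... | inj₁ grows   = inj₁ (≤-<-trans z≤n grows)
    ... | inj₂ settled = inj₂ settled
    large-or-settled A (suc t) with large-or-settled A t
    ... | inj₂ settled = inj₂ (bootStep-mono settled)
    ... | inj₁ large with grows-or-settles (bootIter r G A (suc t))
    ...   | inj₁ grows   = inj₁ (≤-<-trans large grows)
    ...   | inj₂ settled = inj₂ settled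

  -- A strictly growing chain of subsets of Fin n settles within n steps.
  bootIter-settled : ∀ A → bootStep r G (bootIter r G A n) ⊆ bootIter r G A n
  bootIter-settled A with large-or-settled A n
  ... | inj₁ n<∣∣    = contradiction (<-≤-trans n<∣∣ (∣p∣≤n (bootIter r G A (suc n)))) (n≮n n)
  ... | inj₂ settled = settled

≡⊤⊎∃∉ : ∀ {n} (p : Subset n) → p ≡ ⊤ ⊎ ∃[ v ] (v ∉ p)
≡⊤⊎∃∉ p with any? (λ v → ¬? (v ∈? p))
... | yes missing = inj₂ missing
... | no none     = inj₁ (⊆-antisym ⊆⊤ (λ {v} _ → decidable-stable (v ∈? p) (λ v∉p → none (v , v∉p))))

module Closure {n} (G : Graph n) where

  Closed : (Fin n → Set) → Set
  Closed P = ∀ {v u w} → u ≢ w → Adj G v u → Adj G v w → P u → P w → P v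

  closure : Subset n → Subset n
  closure A = bootIter 2 G A n

  ⊆-closure : ∀ {A} → A ⊆ closure A
  ⊆-closure = A⊆bootIter 2 G n

  closure-closed : ∀ A → Closed (_∈ closure A)
  closure-closed A u≢w v~u v~w u∈ w∈ = bootIter-settled 2 G A (∈-bootStep⁺ 2 G
    (≢-members⇒2≤∣p∣ u≢w (x∈p∩q⁺ (∈-neighbours⁺ G v~u , u∈))
                         (x∈p∩q⁺ (∈-neighbours⁺ G v~w , w∈))))

  closure-minimal : ∀ {A} {P : Fin n → Set} → (∀ {v} → v ∈ A → P v) → Closed P →
    ∀ {v} → v ∈ closure A → P v
  closure-minimal {A} {P} A⊆P P-closed = go n
    where
    go : ∀ t {v} → v ∈ bootIter 2 G A t → P v
    go zero    v∈A = A⊆P v∈A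
    go (suc t) {v} v∈ with ∈-bootStep⁻ 2 G v∈
    ... | inj₁ v∈At = go t v∈At
    ... | inj₂ 2≤ with 2≤∣p∣⇒∃≢ 2≤ v
    ...   | w , w∈ , _ with 2≤∣p∣⇒∃≢ 2≤ w
    ...     | u , u∈ , u≢w with x∈p∩q⁻ _ _ u∈ | x∈p∩q⁻ _ _ w∈
    ...       | u∈N , u∈At | w∈N , w∈At =
      P-closed u≢w (∈-neighbours⁻ G u∈N) (∈-neighbours⁻ G w∈N) (go t u∈At) (go t w∈At)

  ⟪_,_⟫ : Fin n → Fin n → Subset n
  ⟪ a , b ⟫ = closure (⁅ a ⁆ ∪ ⁅ b ⁆)

  left∈⟪⟫ : ∀ a b → a ∈ ⟪ a , b ⟫
  left∈⟪⟫ a b = ⊆-closure (x∈p∪q⁺ (inj₁ (x∈⁅x⁆ a)))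

  right∈⟪⟫ : ∀ a b → b ∈ ⟪ a , b ⟫
  right∈⟪⟫ a b = ⊆-closure (x∈p∪q⁺ (inj₂ (x∈⁅x⁆ b)))

  ⟪⟫-minimal : ∀ {a b} {P : Fin n → Set} → P a → P b → Closed P → ∀ {v} → v ∈ ⟪ a , b ⟫ → P v
  ⟪⟫-minimal {a} {b} {P} Pa Pb = closure-minimal pair⊆P
    where
    pair⊆P : ∀ {v} → v ∈ ⁅ a ⁆ ∪ ⁅ b ⁆ → P v
    pair⊆P v∈ with x∈p∪q⁻ ⁅ a ⁆ ⁅ b ⁆ v∈
    ... | inj₁ v∈⁅a⁆ = subst P (sym (x∈⁅y⁆⇒x≡y a v∈⁅a⁆)) Pa
    ... | inj₂ v∈⁅b⁆ = subst P (sym (x∈⁅y⁆⇒x≡y b v∈⁅b⁆)) Pb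

  Boundary : Subset n → Fin n → Set
  Boundary S x = x ∈ S × ∃[ y ] (y ∉ S × Adj G y x)

  Boundary? : ∀ S x → Dec (Boundary S x)
  Boundary? S x = x ∈? S ×-dec any? (λ y → ¬? (y ∈? S) ×-dec Adj? G y x)

  sole-boundary⇒outside-closed : ∀ {S x} → (∀ {v} → Boundary S v → v ≡ x) → Closed (λ v → v ∉ S ⊎ v ≡ x)
  sole-boundary⇒outside-closed {S} {x} sole {v} {u} {w} u≢w v~u v~w Ru Rw with v ∈? S
  ... | no v∉S  = inj₁ v∉S
  ... | yes v∈S with via v~u Ru | via v~w Rw
    where
    via : ∀ {z} → Adj G v z → z ∉ S ⊎ z ≡ x → v ≡ x ⊎ z ≡ x
    via v~z (inj₁ z∉S) = inj₁ (sole (v∈S , _ , z∉S , Adj-sym G v~z))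
    via v~z (inj₂ z≡x) = inj₂ z≡x
  ...   | inj₁ v≡x | _        = inj₂ v≡x
  ...   | inj₂ _   | inj₁ v≡x = inj₂ v≡x
  ...   | inj₂ u≡x | inj₂ w≡x = contradiction (trans u≡x (sym w≡x)) u≢w

module Walk {n} {G : Graph n} {S : Subset n} where

  walk-start : ∀ {u v} → WalkIn G S u v → u ∈ S
  walk-start (here u∈)     = u∈
  walk-start (step u∈ _ _) = u∈

  snoc : ∀ {u w v} → WalkIn G S u w → Adj G w v → v ∈ S → WalkIn G S u v
  snoc (here u∈)       w~v v∈ = step u∈ w~v (here v∈)
  snoc (step u∈ u~ ws) w~v v∈ = step u∈ u~ (snoc ws w~v v∈)

  _++ʷ_ : ∀ {u w v} → WalkIn G S u w → WalkIn G S w v → WalkIn G S u v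
  here _        ++ʷ ws′ = ws′
  step u∈ u~ ws ++ʷ ws′ = step u∈ u~ (ws ++ʷ ws′)

  reverseʷ : ∀ {u v} → WalkIn G S u v → WalkIn G S v u
  reverseʷ (here u∈)       = here u∈
  reverseʷ (step u∈ u~ ws) = snoc (reverseʷ ws) (Adj-sym G u~) u∈

  crossing-edge : ∀ {P : Fin n → Set} → (∀ x → Dec (P x)) → ∀ {u v} → P u → ¬ P v → WalkIn G S u v →
    ∃[ p ] ∃[ q ] (P p × ¬ P q × Adj G p q × p ∈ S × q ∈ S)
  crossing-edge P? Pu ¬Pv (here _) = contradiction Pu ¬Pv
  crossing-edge P? Pu ¬Pv (step {w = w} u∈ u~w ws) with P? w
  ... | yes Pw = crossing-edge P? Pw ¬Pv ws
  ... | no ¬Pw = _ , w , Pu , ¬Pw , u~w , u∈ , walk-start ws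

next5-classify : ∀ i j → i ≡ j ⊎ j ≡ next5 i ⊎ i ≡ next5 j ⊎ j ≡ next5 (next5 i) ⊎ i ≡ next5 (next5 j)
next5-classify = from-yes (all? λ i → all? λ j →
  i ≟ j ⊎-dec j ≟ next5 i ⊎-dec i ≟ next5 j ⊎-dec j ≟ next5 (next5 i) ⊎-dec i ≟ next5 (next5 j))

next5-period : ∀ i → next5 (next5 (next5 (next5 (next5 i)))) ≡ i
next5-period zero                         = refl
next5-period (suc zero)                   = refl
next5-period (suc (suc zero))             = refl
next5-period (suc (suc (suc zero)))       = refl
next5-period (suc (suc (suc (suc zero)))) = refl

pentagon⇒HasInducedC5 : ∀ {n} (G : Graph n) (f : Fin 5 → Fin n) →
  (∀ i → Adj G (f i) (f (next5 i))) → (∀ i → ¬ Adj G (f i) (f (next5 (next5 i)))) → HasInducedC5 G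
pentagon⇒HasInducedC5 G f edge chord = f , injective , only-cycle-edges , edge
  where
  only-cycle-edges : ∀ i j → Adj G (f i) (f j) → j ≡ next5 i ⊎ i ≡ next5 j
  only-cycle-edges i j fi~fj with next5-classify i j
  ... | inj₁ refl                        = contradiction refl (Adj⇒≢ G fi~fj)
  ... | inj₂ (inj₁ j≡)                   = inj₁ j≡
  ... | inj₂ (inj₂ (inj₁ i≡))            = inj₂ i≡
  ... | inj₂ (inj₂ (inj₂ (inj₁ refl)))   = contradiction fi~fj (chord i)
  ... | inj₂ (inj₂ (inj₂ (inj₂ refl)))   = contradiction (Adj-sym G fi~fj) (chord j)

  two-apart-distinct : ∀ i → f i ≢ f (next5 (next5 i))
  two-apart-distinct i fi≡ = chord k (subst (λ j → Adj G (f k) (f j)) (sym (next5-period i)) k~i)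
    where
    k = next5 (next5 (next5 i))
    k~i : Adj G (f k) (f i)
    k~i = Adj-sym G (subst (λ v → Adj G v (f k)) (sym fi≡) (edge (next5 (next5 i))))

  injective : Injective _≡_ _≡_ f
  injective {i} {j} fi≡fj with next5-classify i j
  ... | inj₁ i≡j                         = i≡j
  ... | inj₂ (inj₁ refl)                 = contradiction fi≡fj (Adj⇒≢ G (edge i))
  ... | inj₂ (inj₂ (inj₁ refl))          = contradiction (sym fi≡fj) (Adj⇒≢ G (edge j))
  ... | inj₂ (inj₂ (inj₂ (inj₁ refl)))   = contradiction fi≡fj (two-apart-distinct i)
  ... | inj₂ (inj₂ (inj₂ (inj₂ refl)))   = contradiction (sym fi≡fj) (two-apart-distinct j)

module DiameterTwoC5Free {n} {G : Graph n} (distance≤2 : ∀ u v → DistLe2 G u v) (C5-free : ¬ HasInducedC5 G) where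
  open Closure G

  boundary-vertex-dominates : ∀ {S} → Closed (_∈ S) → ∀ {y x c} → y ∉ S → Adj G y x → x ∈ S →
    c ∈ S → c ≢ x → Adj G x c
  boundary-vertex-dominates {S} S-closed {y} {x} {c} y∉S y~x x∈S c∈S c≢x with Adj? G x c
  ... | yes x~c = x~c
  ... | no x≁c  = ⊥-elim (pentagon (distance≤2 y c) (distance≤2 x c))
    where
    x≢c : x ≢ c
    x≢c x≡c = c≢x (sym x≡c)

    y≁c : ¬ Adj G y c
    y≁c y~c = y∉S (S-closed x≢c y~x y~c x∈S c∈S)

    pentagon : DistLe2 G y c → DistLe2 G x c → ⊥
    pentagon (inj₁ y≡c)        _                  = y∉S (subst (_∈ S) (sym y≡c) c∈S)
    pentagon (inj₂ (inj₁ y~c)) _                  = y≁c y~c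
    pentagon _                 (inj₁ x≡c)         = x≢c x≡c
    pentagon _                 (inj₂ (inj₁ x~c))  = x≁c x~c
    pentagon (inj₂ (inj₂ (w , y~w , w~c))) (inj₂ (inj₂ (u , x~u , u~c))) =
      C5-free (pentagon⇒HasInducedC5 G cycle edge chord)
      where
      cycle : Fin 5 → Fin n
      cycle = lookup (y ∷ x ∷ u ∷ c ∷ w ∷ [])

      u∈S : u ∈ S
      u∈S = S-closed x≢c (Adj-sym G x~u) u~c x∈S c∈S

      w∉S : w ∉ S
      w∉S w∈S with w ≟ x
      ... | yes w≡x = x≁c (subst (λ v → Adj G v c) w≡x w~c)
      ... | no w≢x  = y∉S (S-closed (λ x≡w → w≢x (sym x≡w)) y~x y~w x∈S w∈S)

      edge : ∀ i → Adj G (cycle i) (cycle (next5 i))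
      edge zero                         = y~x
      edge (suc zero)                   = x~u
      edge (suc (suc zero))             = u~c
      edge (suc (suc (suc zero)))       = Adj-sym G w~c
      edge (suc (suc (suc (suc zero)))) = Adj-sym G y~w

      chord : ∀ i → ¬ Adj G (cycle i) (cycle (next5 (next5 i)))
      chord zero y~u                         = y∉S (S-closed (Adj⇒≢ G x~u) y~x y~u x∈S u∈S)
      chord (suc zero)                       = x≁c
      chord (suc (suc zero)) u~w             = w∉S (S-closed (Adj⇒≢ G u~c) (Adj-sym G u~w) w~c u∈S c∈S)
      chord (suc (suc (suc zero))) c~y       = y≁c (Adj-sym G c~y)
      chord (suc (suc (suc (suc zero)))) w~x = w∉S (S-closed x≢c w~x w~c x∈S c∈S)

  sole-boundary⇒universal : ∀ {S x s} → Closed (_∈ S) → Boundary S x → (∀ {v} → Boundary S v → v ≡ x) →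
    s ∈ S → s ≢ x → ∀ u → u ≢ x → Adj G x u
  sole-boundary⇒universal {S} {x} {s} S-closed (x∈S , y , y∉S , y~x) sole s∈S s≢x u u≢x with u ∈? S
  ... | yes u∈S = boundary-vertex-dominates S-closed y∉S y~x x∈S u∈S u≢x
  ... | no u∉S  = via (distance≤2 u s)
    where
    via : DistLe2 G u s → Adj G x u
    via (inj₁ u≡s)        = contradiction (subst (_∈ S) (sym u≡s) s∈S) u∉S
    via (inj₂ (inj₁ u~s)) = contradiction (sole (s∈S , u , u∉S , u~s)) s≢x
    via (inj₂ (inj₂ (w , u~w , w~s))) with w ∈? S
    ... | yes w∈S = subst (λ v → Adj G v u) (sole (w∈S , u , u∉S , u~w)) (Adj-sym G u~w)
    ... | no w∉S  = contradiction (sole (s∈S , w , w∉S , w~s)) s≢x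

module _ {n} {G : Graph n} {x : Fin n} (universal : ∀ u → u ≢ x → Adj G x u) where
  open Closure G
  open Walk

  walk-to-centre : ∀ {T p} → p ∈ T → x ∈ T → WalkIn G T p x
  walk-to-centre {T} {p} p∈T x∈T with p ≟ x
  ... | yes p≡x = subst (λ v → WalkIn G T v x) (sym p≡x) (here x∈T)
  ... | no p≢x  = step p∈T (Adj-sym G (universal p p≢x)) (here x∈T)

  module _ {w} (w≢x : w ≢ x) where

    private
      x∈B : x ∈ ⟪ x , w ⟫
      x∈B = left∈⟪⟫ x w

      w∈B : w ∈ ⟪ x , w ⟫
      w∈B = right∈⟪⟫ x w

    walk-avoiding-centre : ∀ {v} → v ∈ ⟪ x , w ⟫ → v ≢ x → WalkIn G (⟪ x , w ⟫ ─ x) w v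
    walk-avoiding-centre = proj₂ ∘ ⟪⟫-minimal {P = P} Px Pw P-closed
      where
      P : Fin n → Set
      P v = v ∈ ⟪ x , w ⟫ × (v ≢ x → WalkIn G (⟪ x , w ⟫ ─ x) w v)

      Px : P x
      Px = x∈B , λ x≢x → contradiction refl x≢x

      Pw : P w
      Pw = w∈B , λ _ → here (∈-─⁺ w∈B w≢x)

      P-closed : Closed P
      P-closed {v} {u} {u′} u≢u′ v~u v~u′ (u∈B , walk-u) (u′∈B , walk-u′) = v∈B , walk-v
        where
        v∈B : v ∈ ⟪ x , w ⟫
        v∈B = closure-closed _ u≢u′ v~u v~u′ u∈B u′∈B

        walk-v : v ≢ x → WalkIn G (⟪ x , w ⟫ ─ x) w v
        walk-v v≢x with u ≟ x
        ... | no u≢x  = snoc (walk-u u≢x) (Adj-sym G v~u) (∈-─⁺ v∈B v≢x)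
        ... | yes u≡x =
          snoc (walk-u′ (λ u′≡x → u≢u′ (trans u≡x (sym u′≡x)))) (Adj-sym G v~u′) (∈-─⁺ v∈B v≢x)

    ⟪x,w⟫-biconnected : Biconn G ⟪ x , w ⟫
    ⟪x,w⟫-biconnected = connected , no-cut-vertex
      where
      connected : ConnectedIn G ⟪ x , w ⟫
      connected p q p∈ q∈ = walk-to-centre p∈ x∈B ++ʷ reverseʷ (walk-to-centre q∈ x∈B)

      no-cut-vertex : ∀ z → ¬ CutVertexIn G ⟪ x , w ⟫ z
      no-cut-vertex z (_ , p , q , p∈ , q∈ , ¬walk) with z ≟ x
      ... | yes refl = ¬walk (reverseʷ (avoid p∈) ++ʷ avoid q∈)
        where
        avoid : ∀ {v} → v ∈ ⟪ x , w ⟫ ─ x → WalkIn G (⟪ x , w ⟫ ─ x) w v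
        avoid v∈ = walk-avoiding-centre (proj₁ (∈-─⁻ v∈)) (proj₂ (∈-─⁻ v∈))
      ... | no z≢x = ¬walk (walk-to-centre p∈ x∈B-z ++ʷ reverseʷ (walk-to-centre q∈ x∈B-z))
        where
        x∈B-z : x ∈ ⟪ x , w ⟫ ─ z
        x∈B-z = ∈-─⁺ x∈B (λ x≡z → z≢x (sym x≡z))

    ⟪x,w⟫-maximal : ∀ T → ⟪ x , w ⟫ ⊆ T → Biconn G T → T ≡ ⟪ x , w ⟫
    ⟪x,w⟫-maximal T B⊆T (_ , no-cut-vertex) = ⊆-antisym T⊆B B⊆T
      where
      T⊆B : T ⊆ ⟪ x , w ⟫
      T⊆B {t} t∈T with t ∈? ⟪ x , w ⟫
      ... | yes t∈B = t∈B
      ... | no t∉B  = contradiction x-separates (no-cut-vertex x)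
        where
        t≢x : t ≢ x
        t≢x t≡x = t∉B (subst (_∈ ⟪ x , w ⟫) (sym t≡x) x∈B)

        cannot-leave : ¬ WalkIn G (T ─ x) w t
        cannot-leave walk with crossing-edge (_∈? ⟪ x , w ⟫) w∈B t∉B walk
        ... | p , q , p∈B , q∉B , p~q , p∈T-x , q∈T-x =
          q∉B (closure-closed _ (proj₂ (∈-─⁻ p∈T-x)) (Adj-sym G p~q)
                (Adj-sym G (universal q (proj₂ (∈-─⁻ q∈T-x)))) p∈B x∈B)

        x-separates : CutVertexIn G T x
        x-separates = B⊆T x∈B , w , t , ∈-─⁺ (B⊆T w∈B) w≢x , ∈-─⁺ t∈T t≢x , cannot-leave

    ⟪x,w⟫-isBlock : IsBlock G ⟪ x , w ⟫
    ⟪x,w⟫-isBlock = ⟪x,w⟫-biconnected , ⟪x,w⟫-maximal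

module _ {n} {G : Graph n} (connected : Connected G) (at-most-two-blocks : AtMostTwoBlocks G)
  (distance≤2 : ∀ u v → DistLe2 G u v) (C5-free : ¬ HasInducedC5 G) where
  open Closure G
  open DiameterTwoC5Free {G = G} distance≤2 C5-free
  open Walk

  PairClosureAbove : Subset n → Set
  PairClosureAbove S = ∃[ a ] ∃[ b ] (a ≢ b × S ⊂ ⟪ a , b ⟫)

  ⟪⟫≡⊤⇒TwoBG : ∀ {a b} → a ≢ b → ⟪ a , b ⟫ ≡ ⊤ → TwoBG G
  ⟪⟫≡⊤⇒TwoBG {a} {b} a≢b percolates = a , b , a≢b , n , percolates

  two-boundary-vertices⇒⊂ : ∀ {S x x′} → Closed (_∈ S) → Boundary S x → Boundary S x′ → x ≢ x′ →
    PairClosureAbove S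
  two-boundary-vertices⇒⊂ {S} {x} {x′} S-closed (x∈S , y , y∉S , y~x) (x′∈S , y′ , y′∉S , y′~x′)
                          x≢x′ =
    y , x′ , y≢x′ , S⊆T , y , left∈⟪⟫ y x′ , y∉S
    where
    y≢x′ : y ≢ x′
    y≢x′ y≡x′ = y∉S (subst (_∈ S) (sym y≡x′) x′∈S)

    dominates : ∀ {z v c} → z ∉ S → Adj G z v → v ∈ S → c ∈ S → c ≢ v → Adj G v c
    dominates = boundary-vertex-dominates S-closed

    x∈T : x ∈ ⟪ y , x′ ⟫
    x∈T = closure-closed _ y≢x′ (Adj-sym G y~x)
            (dominates y∉S y~x x∈S x′∈S (λ x′≡x → x≢x′ (sym x′≡x))) (left∈⟪⟫ y x′) (right∈⟪⟫ y x′)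

    S⊆T : S ⊆ ⟪ y , x′ ⟫
    S⊆T {c} c∈S with c ≟ x | c ≟ x′
    ... | yes refl | _        = x∈T
    ... | no _     | yes refl = right∈⟪⟫ y x′
    ... | no c≢x   | no c≢x′  = closure-closed _ x≢x′
      (Adj-sym G (dominates y∉S y~x x∈S c∈S c≢x)) (Adj-sym G (dominates y′∉S y′~x′ x′∈S c∈S c≢x′))
      x∈T (right∈⟪⟫ y x′)

  sole-boundary⇒TwoBG : ∀ {S x} → Closed (_∈ S) → Boundary S x → (∀ {v} → Boundary S v → v ≡ x) →
    ∃[ s ] (s ∈ S × s ≢ x) → TwoBG G
  sole-boundary⇒TwoBG {S} {x} S-closed x-boundary@(x∈S , y , y∉S , y~x) sole (s , s∈S , s≢x) =
    [ ⟪⟫≡⊤⇒TwoBG s≢y , (λ (v , v∉⟪s,y⟫) → ⊥-elim (three-blocks v∉⟪s,y⟫)) ]′ (≡⊤⊎∃∉ ⟪ s , y ⟫)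
    where
    s≢y : s ≢ y
    s≢y s≡y = y∉S (subst (_∈ S) s≡y s∈S)

    y≢x : y ≢ x
    y≢x y≡x = y∉S (subst (_∈ S) (sym y≡x) x∈S)

    universal : ∀ u → u ≢ x → Adj G x u
    universal = sole-boundary⇒universal S-closed x-boundary sole s∈S s≢x

    x∈⟪s,y⟫ : x ∈ ⟪ s , y ⟫
    x∈⟪s,y⟫ = closure-closed _ s≢y (universal s s≢x) (Adj-sym G y~x) (left∈⟪⟫ s y) (right∈⟪⟫ s y)

    ⟪x,w⟫⊆⟪s,y⟫ : ∀ {w} → w ∈ ⟪ s , y ⟫ → ∀ {u} → u ∈ ⟪ x , w ⟫ → u ∈ ⟪ s , y ⟫
    ⟪x,w⟫⊆⟪s,y⟫ w∈ = ⟪⟫-minimal x∈⟪s,y⟫ w∈ (closure-closed _)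

    ⟪x,y⟫-outside : ∀ {u} → u ∈ ⟪ x , y ⟫ → u ∉ S ⊎ u ≡ x
    ⟪x,y⟫-outside = ⟪⟫-minimal (inj₂ refl) (inj₁ y∉S) (sole-boundary⇒outside-closed sole)

    three-blocks : ∀ {v} → v ∉ ⟪ s , y ⟫ → ⊥
    three-blocks {v} v∉⟪s,y⟫ with at-most-two-blocks _ _ _
      (⟪x,w⟫-isBlock universal s≢x) (⟪x,w⟫-isBlock universal y≢x) (⟪x,w⟫-isBlock universal v≢x)
      where
      v≢x : v ≢ x
      v≢x v≡x = v∉⟪s,y⟫ (subst (_∈ ⟪ s , y ⟫) (sym v≡x) x∈⟪s,y⟫)
    ... | inj₁ ⟪x,s⟫≡⟪x,y⟫ =
      [ (λ s∉S → s∉S s∈S) , s≢x ]′ (⟪x,y⟫-outside (subst (s ∈_) ⟪x,s⟫≡⟪x,y⟫ (right∈⟪⟫ x s)))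
    ... | inj₂ (inj₁ ⟪x,s⟫≡⟪x,v⟫) =
      v∉⟪s,y⟫ (⟪x,w⟫⊆⟪s,y⟫ (left∈⟪⟫ s y) (subst (v ∈_) (sym ⟪x,s⟫≡⟪x,v⟫) (right∈⟪⟫ x v)))
    ... | inj₂ (inj₂ ⟪x,y⟫≡⟪x,v⟫) =
      v∉⟪s,y⟫ (⟪x,w⟫⊆⟪s,y⟫ (right∈⟪⟫ s y) (subst (v ∈_) (sym ⟪x,y⟫≡⟪x,v⟫) (right∈⟪⟫ x v)))

  grow-or-percolate : ∀ {a b v} → a ≢ b → v ∉ ⟪ a , b ⟫ → TwoBG G ⊎ PairClosureAbove ⟪ a , b ⟫
  grow-or-percolate {a} {b} {v} a≢b v∉S
    with crossing-edge (_∈? ⟪ a , b ⟫) (left∈⟪⟫ a b) v∉S (connected a v ∈⊤ ∈⊤)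
  ... | x , y , x∈S , y∉S , x~y , _ = from-boundary (x∈S , y , y∉S , Adj-sym G x~y)
    where
    S-closed : Closed (_∈ ⟪ a , b ⟫)
    S-closed = closure-closed _

    another-member : ∀ x → ∃[ s ] (s ∈ ⟪ a , b ⟫ × s ≢ x)
    another-member x with a ≟ x
    ... | no a≢x  = a , left∈⟪⟫ a b , a≢x
    ... | yes a≡x = b , right∈⟪⟫ a b , λ b≡x → a≢b (trans a≡x (sym b≡x))

    from-boundary : ∀ {x} → Boundary ⟪ a , b ⟫ x → TwoBG G ⊎ PairClosureAbove ⟪ a , b ⟫
    from-boundary {x} x-boundary with any? (λ x′ → Boundary? ⟪ a , b ⟫ x′ ×-dec ¬? (x′ ≟ x))
    ... | yes (x′ , x′-boundary , x′≢x) =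
      inj₂ (two-boundary-vertices⇒⊂ S-closed x-boundary x′-boundary (λ x≡x′ → x′≢x (sym x≡x′)))
    ... | no no-other-boundary = inj₁ (sole-boundary⇒TwoBG S-closed x-boundary sole (another-member x))
      where
      sole : ∀ {u} → Boundary ⟪ a , b ⟫ u → u ≡ x
      sole {u} u-boundary = decidable-stable (u ≟ x) (λ u≢x → no-other-boundary (u , u-boundary , u≢x))

  TwoBG-within : ∀ k {a b} → a ≢ b → n ≤ k + ∣ ⟪ a , b ⟫ ∣ → TwoBG G
  TwoBG-within zero    {a} {b} a≢b n≤∣S∣ =
    ⟪⟫≡⊤⇒TwoBG a≢b (∣p∣≡n⇒p≡⊤ (≤-antisym (∣p∣≤n ⟪ a , b ⟫) n≤∣S∣))
  TwoBG-within (suc k) {a} {b} a≢b n≤ with ≡⊤⊎∃∉ ⟪ a , b ⟫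
  ... | inj₁ percolates = ⟪⟫≡⊤⇒TwoBG a≢b percolates
  ... | inj₂ (v , v∉S) with grow-or-percolate a≢b v∉S
  ...   | inj₁ twoBG                     = twoBG
  ...   | inj₂ (a′ , b′ , a′≢b′ , S⊂S′) = TwoBG-within k a′≢b′ (begin
    n                          ≤⟨ n≤ ⟩
    suc k + ∣ ⟪ a , b ⟫ ∣      ≡⟨ sym (+-suc k _) ⟩
    k + suc ∣ ⟪ a , b ⟫ ∣      ≤⟨ +-monoʳ-≤ k (p⊂q⇒∣p∣<∣q∣ S⊂S′) ⟩
    k + ∣ ⟪ a′ , b′ ⟫ ∣        ∎)
    where open ≤-Reasoning

mainTheorem1 : (n : ℕ) (G : Graph n) → 3 ≤ n → Connected G → AtMostTwoBlocks G →
    Diameter2 G → ¬ HasInducedC5 G → TwoBG G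
mainTheorem1 n@(suc (suc _)) G (s≤s (s≤s _)) connected at-most-two-blocks (_ , distance≤2 , _) C5-free =
  TwoBG-within connected at-most-two-blocks distance≤2 C5-free n {zero} {suc zero} (λ ()) (m≤m+n n _)
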